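{- Let $q$ be a prime, and suppose $k, y$ are positive integers with \[ (2^{k}-1)(3^{k}-1)=y^{q}. \] Then: (1) $\nu_{2}(k) \geq q-2$; (2) for every $p\in\{3,5,7\}$ with $p \le q$, we have $\nu_{p}(k) \geq q-1$.
   Context: For a prime $p$ and a nonzero integer $n$, $\nu_p(n)$ denotes the $p$-adic valuation of $n$, i.e. the exponent of $p$ in the prime factorization of $n$. -}

module Defs where

open import Data.Nat using (ℕ; zero; suc; _+_; _*_; _∸_; _^_; _/_)
open import Data.Nat.Divisibility using (_∣?_)
open import Relation.Nullary using (yes; no)

-- p-adic valuation ν_p(n): the exponent of p in n, for a prime p and n ≥ 1.
-- Computed by repeatedly dividing by p; the fuel argument (initialised to n)
-- bounds the number of divisions, which is enough since p^v ≤ n for p ≥ 2, n ≥ 1.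
-- (Conventions for p ≤ 1 or n = 0 are irrelevant: only used with prime p, n ≥ 1.)
νFuel : ℕ → (p : ℕ) → ℕ → ℕ
νFuel zero    p         n = 0
νFuel (suc f) zero      n = 0
νFuel (suc f) (suc zero) n = 0
νFuel (suc f) p@(suc (suc _)) n with p ∣? n
... | yes _ = suc (νFuel f p (n / p))
... | no  _ = 0

ν : (p : ℕ) → ℕ → ℕ
ν p n = νFuel n p n

-- For every prime p the sum ν_p(2^k − 1) + ν_p(3^k − 1) = q ν_p(y) is a multiple of q, and
-- lifting the exponent, ν_p(x^n − 1) = ν_p(x − 1) + ν_p(n) for p ∣ x − 1 (and 4 ∣ x − 1 if p = 2),
-- proved from the truncated binomial expansion of (1 + a)^m, evaluates it. For p = 2 it is 1 if
-- k is odd, which q cannot divide, and ν_2(k) + 2 otherwise. Hence 2^(q−2) ∣ k; writing k as a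
-- multiple of 2, 4 and 6 (the last using the bound for p = 3), the sum for p = 3, 5, 7 becomes
-- 1 + ν_3(k), resp. 2 (1 + ν_p(k)), because 2^2 − 1 = 3 and 2^4 − 1, 3^4 − 1, 2^6 − 1, 3^6 − 1
-- are each divisible exactly once by 5 resp. 7; the odd prime q then divides 1 + ν_p(k).

module Submission where

open import Defs
open import Data.Nat
open import Data.Nat.Properties
open import Data.Nat.Divisibility
open import Data.Nat.DivMod using (m*n/n≡m)
open import Data.Nat.Primality using (Prime; euclidsLemma; prime?; prime[2])
open import Data.Nat.LCM using (lcm-least)
open import Data.Nat.Combinatorics using (_C_; nC1≡n; nCk+nC[k+1]≡[n+1]C[k+1])
open import Data.Nat.Tactic.RingSolver using (solve-∀)
open import Data.Product using (_×_; _,_; ∃-syntax)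
open import Data.Sum using (_⊎_; inj₁; inj₂; [_,_]′)
open import Function using (_∘_)
open import Relation.Nullary using (¬_; yes; no; contradiction)
open import Relation.Nullary.Decidable using (from-yes)
open import Relation.Binary.PropositionalEquality

m^n∣m^o : ∀ m {n o} → n ≤ o → m ^ n ∣ m ^ o
m^n∣m^o m {n} {o} n≤o = divides (m ^ (o ∸ n)) (begin
  m ^ o                ≡⟨ cong (m ^_) (m+[n∸m]≡n n≤o) ⟨
  m ^ (n + (o ∸ n))    ≡⟨ ^-distribˡ-+-* m n (o ∸ n) ⟩
  m ^ n * m ^ (o ∸ n)  ≡⟨ *-comm (m ^ n) _ ⟩
  m ^ (o ∸ n) * m ^ n  ∎)
  where open ≡-Reasoning

0<x^k∸1 : ∀ x .{{_ : NonTrivial x}} {k} → 0 < k → 0 < x ^ k ∸ 1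
0<x^k∸1 x@(2+ _) {suc k} _ = ≤-trans (s≤s z≤n) (∸-monoˡ-≤ 1 (m≤m*n x (x ^ k) {{m^n≢0 x k}}))

p∣n+n⇒p∣n : ∀ {p n} → Prime p → 3 ≤ p → p ∣ n + n → p ∣ n
p∣n+n⇒p∣n {p} {n} p-prime 3≤p p∣n+n
  with euclidsLemma 2 n p-prime (subst (p ∣_) (cong (n +_) (sym (+-identityʳ n))) p∣n+n)
... | inj₁ p∣2 = contradiction p∣2 (>⇒∤ 3≤p)
... | inj₂ p∣n = p∣n

[1+a]^m-expansion : ∀ a m → ∃[ z ] (1 + a) ^ m ≡ 1 + m * a + (m C 2) * (a * a) + a * a * a * z
[1+a]^m-expansion a zero = 0 , cong suc (sym (*-zeroʳ (a * a * a)))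
[1+a]^m-expansion a (suc m) =
  let (z , eq) = [1+a]^m-expansion a m in
  z + m C 2 + a * z , (begin
    (1 + a) * (1 + a) ^ m
      ≡⟨ cong ((1 + a) *_) eq ⟩
    (1 + a) * (1 + m * a + (m C 2) * (a * a) + a * a * a * z)
      ≡⟨ multiply-out a m (m C 2) z ⟩
    1 + suc m * a + (m + m C 2) * (a * a) + a * a * a * (z + m C 2 + a * z)
      ≡⟨ cong (λ c → 1 + suc m * a + c * (a * a) + a * a * a * (z + m C 2 + a * z)) [1+m]C2≡m+mC2 ⟩
    1 + suc m * a + (suc m C 2) * (a * a) + a * a * a * (z + m C 2 + a * z) ∎)
  where
  open ≡-Reasoning
  multiply-out : ∀ a m c z → (1 + a) * (1 + m * a + c * (a * a) + a * a * a * z)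
                           ≡ 1 + (1 + m) * a + (m + c) * (a * a) + a * a * a * (z + c + a * z)
  multiply-out = solve-∀
  [1+m]C2≡m+mC2 : m + m C 2 ≡ suc m C 2
  [1+m]C2≡m+mC2 = trans (cong (_+ m C 2) (sym (nC1≡n m))) (nCk+nC[k+1]≡[n+1]C[k+1] m 1)

prime[3] : Prime 3
prime[3] = from-yes (prime? 3)

prime[5] : Prime 5
prime[5] = from-yes (prime? 5)

prime[7] : Prime 7
prime[7] = from-yes (prime? 7)

record HasValuation (p n v : ℕ) : Set where
  constructor valuation
  field
    cofactor       : ℕ
    n≡p^v*cofactor : n ≡ p ^ v * cofactor
    p∤cofactor     : ¬ p ∣ cofactor

hasValuation-0 : ∀ {p n} → ¬ p ∣ n → HasValuation p n 0
hasValuation-0 {n = n} p∤n = valuation n (sym (*-identityˡ n)) p∤n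

hasValuation-*p : ∀ {p m v} → HasValuation p m v → HasValuation p (m * p) (suc v)
hasValuation-*p {p} {m} {v} (valuation u m≡p^v*u p∤u) = valuation u m*p≡p^[1+v]*u p∤u
  where
  m*p≡p^[1+v]*u : m * p ≡ p * p ^ v * u
  m*p≡p^[1+v]*u = trans (*-comm m p) (trans (cong (p *_) m≡p^v*u) (sym (*-assoc p (p ^ v) u)))

hasValuation-νFuel : ∀ {r} f {n} → n ≤ f → 0 < n → HasValuation (2+ r) n (νFuel f (2+ r) n)
hasValuation-νFuel zero n≤0 0<n = contradiction (≤-trans 0<n n≤0) λ ()
hasValuation-νFuel {r} (suc f) {n} n≤1+f 0<n with 2+ r ∣? n
... | no p∤n = hasValuation-0 p∤n
... | yes (divides zero refl) = contradiction 0<n λ ()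
... | yes (divides (suc m) refl) rewrite m*n/n≡m (suc m) (2+ r) {{_}} =
  hasValuation-*p (hasValuation-νFuel f 1+m≤f z<s)
  where
  1+m≤f : suc m ≤ f
  1+m≤f = s≤s⁻¹ (≤-trans (m<m*n (suc m) (2+ r) (s≤s (s≤s z≤n))) n≤1+f)

hasValuation-ν : ∀ {p n} .{{_ : NonTrivial p}} → 0 < n → HasValuation p n (ν p n)
hasValuation-ν {2+ r} {n} = hasValuation-νFuel n ≤-refl

module _ {p : ℕ} .{{_ : NonTrivial p}} where

  private instance
    p≢0 : NonZero p
    p≢0 = nonTrivial⇒nonZero p

  p∤1 : ¬ p ∣ 1
  p∤1 = nonTrivial⇒≢1 ∘ ∣1⇒≡1

  p∣p^[1+v]*u : ∀ v u → p ∣ p ^ suc v * u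
  p∣p^[1+v]*u v u = ∣-trans (m∣m*n (p ^ v)) (m∣m*n u)

  hasValuation⇒>0 : ∀ {n v} → HasValuation p n v → 0 < n
  hasValuation⇒>0 (valuation zero _ p∤0) = contradiction (p ∣0) p∤0
  hasValuation⇒>0 {v = v} (valuation (suc u) refl _) =
    >-nonZero⁻¹ (p ^ v * suc u) {{m*n≢0 (p ^ v) (suc u) {{m^n≢0 p v}}}}

  hasValuation-unique : ∀ {n a b} → HasValuation p n a → HasValuation p n b → a ≡ b
  hasValuation-unique {a = zero} {zero} _ _ = refl
  hasValuation-unique {a = zero} {suc b} (valuation u refl p∤u) (valuation u′ eq _) =
    contradiction (subst (p ∣_) (trans (sym eq) (*-identityˡ u)) (p∣p^[1+v]*u b u′)) p∤u
  hasValuation-unique {a = suc a} {zero} (valuation u refl _) (valuation u′ eq p∤u′) =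
    contradiction (subst (p ∣_) (trans eq (*-identityˡ u′)) (p∣p^[1+v]*u a u)) p∤u′
  hasValuation-unique {a = suc a} {suc b} (valuation u refl p∤u) (valuation u′ eq p∤u′) =
    cong suc (hasValuation-unique (valuation u refl p∤u) (valuation u′ p^a*u≡p^b*u′ p∤u′))
    where
    p^a*u≡p^b*u′ : p ^ a * u ≡ p ^ b * u′
    p^a*u≡p^b*u′ = *-cancelˡ-≡ _ _ p
      (trans (sym (*-assoc p (p ^ a) u)) (trans eq (*-assoc p (p ^ b) u′)))

  hasValuation⇒ν≡ : ∀ {n v} → HasValuation p n v → ν p n ≡ v
  hasValuation⇒ν≡ h = hasValuation-unique (hasValuation-ν (hasValuation⇒>0 h)) h

  ν≡1+e⇒hasValuation : ∀ {n e} → ν p n ≡ suc e → HasValuation p n (suc e)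
  ν≡1+e⇒hasValuation {suc n} νn≡1+e = subst (HasValuation p (suc n)) νn≡1+e (hasValuation-ν z<s)

  p∤n⇒ν≡0 : ∀ {n} → ¬ p ∣ n → ν p n ≡ 0
  p∤n⇒ν≡0 = hasValuation⇒ν≡ ∘ hasValuation-0

  ν[x^k∸1]≡0 : ∀ {x k} .{{_ : NonZero x}} → p ∣ x → 0 < k → ν p (x ^ k ∸ 1) ≡ 0
  ν[x^k∸1]≡0 {x} {suc k} p∣x _ =
    p∤n⇒ν≡0 λ p∣x^k∸1 → p∤1 (∣m+n∣m⇒∣n p∣[x^k∸1]+1 p∣x^k∸1)
    where
    p∣[x^k∸1]+1 : p ∣ (x ^ suc k ∸ 1) + 1
    p∣[x^k∸1]+1 = subst (p ∣_) (sym (m∸n+n≡m (m^n>0 x (suc k)))) (∣-trans p∣x (m∣m*n (x ^ k)))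

  p^v∣n : ∀ {n v} → v ≤ ν p n → 0 < n → p ^ v ∣ n
  p^v∣n {n} {v} v≤νn 0<n with hasValuation-ν {p} 0<n
  ... | valuation u n≡p^νn*u _ =
    subst (p ^ v ∣_) (sym n≡p^νn*u) (∣-trans (m^n∣m^o p v≤νn) (m∣m*n u))

module _ {p : ℕ} (p-prime : Prime p) where

  open Prime p-prime using (nontrivial)

  p∤m*n : ∀ {m n} → ¬ p ∣ m → ¬ p ∣ n → ¬ p ∣ m * n
  p∤m*n p∤m p∤n = [ p∤m , p∤n ]′ ∘ euclidsLemma _ _ p-prime

  hasValuation-* : ∀ {m n a b} → HasValuation p m a → HasValuation p n b → HasValuation p (m * n) (a + b)
  hasValuation-* {a = a} {b} (valuation u refl p∤u) (valuation u′ refl p∤u′) =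
    valuation (u * u′)
      (trans (regroup (p ^ a) (p ^ b) u u′) (cong (_* (u * u′)) (sym (^-distribˡ-+-* p a b))))
      (p∤m*n p∤u p∤u′)
    where
    regroup : ∀ P Q u u′ → P * u * (Q * u′) ≡ P * Q * (u * u′)
    regroup = solve-∀

  ν-* : ∀ {m n} → 0 < m → 0 < n → ν p (m * n) ≡ ν p m + ν p n
  ν-* 0<m 0<n = hasValuation⇒ν≡ (hasValuation-* (hasValuation-ν 0<m) (hasValuation-ν 0<n))

  ν-^ : ∀ {n} m → 0 < n → ν p (n ^ m) ≡ m * ν p n
  ν-^ zero    _   = p∤n⇒ν≡0 p∤1
  ν-^ {n} (suc m) 0<n = trans (ν-* 0<n (m^n>0 n {{>-nonZero 0<n}} m)) (cong (ν p n +_) (ν-^ m 0<n))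

  private
    p∤p*x+u : ∀ x {u} → ¬ p ∣ u → ¬ p ∣ p * x + u
    p∤p*x+u x p∤u p∣p*x+u = p∤u (∣m+n∣m⇒∣n p∣p*x+u (m∣m*n x))

    coprime-identity : ∀ p P u m c z → let a = p * P * u in
      m * a + c * (a * a) + a * a * a * z ≡ p * P * (p * (c * P * u * u + p * P * P * u * u * u * z) + m * u)
    coprime-identity = solve-∀

    p∣pC2-identity : ∀ p P u c z → let a = p * P * u in
      p * a + c * p * (a * a) + a * a * a * z ≡ p * (p * P) * (p * (c * P * u * u + P * P * u * u * u * z) + u)
    p∣pC2-identity = solve-∀

    1≤e-identity : ∀ p Q u c z → let a = p * (p * Q) * u in
      p * a + c * (a * a) + a * a * a * z
        ≡ p * (p * (p * Q)) * (p * (c * Q * u * u + p * p * Q * Q * u * u * u * z) + u)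
    1≤e-identity = solve-∀

  hasValuation-[x^m∸1] : ∀ {x e m} → HasValuation p (x ∸ 1) (suc e) → ¬ p ∣ m →
                         HasValuation p (x ^ m ∸ 1) (suc e)
  hasValuation-[x^m∸1] {zero} h _ = contradiction (hasValuation⇒>0 h) λ ()
  hasValuation-[x^m∸1] {suc _} {e} {m} (valuation u refl p∤u) p∤m =
    let (z , eq) = [1+a]^m-expansion (p ^ suc e * u) m in
    valuation _ (trans (cong (_∸ 1) eq) (coprime-identity p (p ^ e) u m (m C 2) z))
      (p∤p*x+u _ (p∤m*n p∤m p∤u))

  -- In (1 + a)^p − 1 = p a + (p C 2) a² + a³ z with a = p^(e+1) u, the middle term gains the
  -- extra factor p from p ∣ p C 2 (p odd) or from 2(e + 1) ≥ e + 3 (e ≥ 1); this fails for p = 2, e = 0.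
  hasValuation-[x^p∸1] : ∀ {x e} → HasValuation p (x ∸ 1) (suc e) → p ∣ p C 2 ⊎ 1 ≤ e →
                         HasValuation p (x ^ p ∸ 1) (suc (suc e))
  hasValuation-[x^p∸1] {zero} h _ = contradiction (hasValuation⇒>0 h) λ ()
  hasValuation-[x^p∸1] {suc _} {e} (valuation u refl p∤u) (inj₁ (divides c pC2≡c*p)) =
    let (z , eq) = [1+a]^m-expansion (p ^ suc e * u) p
        a = p ^ suc e * u in
    valuation _ (begin
      (1 + a) ^ p ∸ 1                                      ≡⟨ cong (_∸ 1) eq ⟩
      p * a + (p C 2) * (a * a) + a * a * a * z
        ≡⟨ cong (λ C → p * a + C * (a * a) + a * a * a * z) pC2≡c*p ⟩
      p * a + c * p * (a * a) + a * a * a * z              ≡⟨ p∣pC2-identity p (p ^ e) u c z ⟩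
      p * (p * p ^ e) * (p * (c * p ^ e * u * u + p ^ e * p ^ e * u * u * u * z) + u) ∎)
      (p∤p*x+u _ p∤u)
    where open ≡-Reasoning
  hasValuation-[x^p∸1] {suc _} {suc e} (valuation u refl p∤u) (inj₂ _) =
    let (z , eq) = [1+a]^m-expansion (p ^ suc (suc e) * u) p in
    valuation _ (trans (cong (_∸ 1) eq) (1≤e-identity p (p ^ e) u (p C 2) z)) (p∤p*x+u _ p∤u)

  hasValuation-[x^p^v∸1] : ∀ {x e} v → HasValuation p (x ∸ 1) (suc e) → p ∣ p C 2 ⊎ 1 ≤ e →
                           HasValuation p (x ^ (p ^ v) ∸ 1) (suc e + v)
  hasValuation-[x^p^v∸1] {x} {e} zero hx _ =
    subst₂ (HasValuation p) (cong (_∸ 1) (sym (*-identityʳ x))) (sym (+-identityʳ (suc e))) hx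
  hasValuation-[x^p^v∸1] {x} {e} (suc v) hx side =
    subst₂ (HasValuation p) (cong (_∸ 1) (^-*-assoc x p (p ^ v))) (sym (+-suc (suc e) v))
      (hasValuation-[x^p^v∸1] v (hasValuation-[x^p∸1] hx side) (inj₂ (s≤s z≤n)))

  hasValuation-[x^n∸1] : ∀ {x e n v} → HasValuation p (x ∸ 1) (suc e) → p ∣ p C 2 ⊎ 1 ≤ e →
                         HasValuation p n v → HasValuation p (x ^ n ∸ 1) (suc e + v)
  hasValuation-[x^n∸1] {x} {v = v} hx side (valuation m refl p∤m) =
    subst (λ y → HasValuation p (y ∸ 1) _) (^-*-assoc x (p ^ v) m)
      (hasValuation-[x^m∸1] (hasValuation-[x^p^v∸1] v hx side) p∤m)

  ν[x^n∸1]≡ν[x∸1] : ∀ {x e n} → ν p (x ∸ 1) ≡ suc e → ¬ p ∣ n → ν p (x ^ n ∸ 1) ≡ suc e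
  ν[x^n∸1]≡ν[x∸1] νx≡1+e p∤n =
    hasValuation⇒ν≡ (hasValuation-[x^m∸1] (ν≡1+e⇒hasValuation νx≡1+e) p∤n)

  ν[x^n∸1]≡ν[x∸1]+ν[n] : ∀ {x e n} → ν p (x ∸ 1) ≡ suc e → p ∣ p C 2 ⊎ 1 ≤ e → 0 < n →
                         ν p (x ^ n ∸ 1) ≡ suc e + ν p n
  ν[x^n∸1]≡ν[x∸1]+ν[n] νx≡1+e side 0<n =
    hasValuation⇒ν≡ (hasValuation-[x^n∸1] (ν≡1+e⇒hasValuation νx≡1+e) side (hasValuation-ν 0<n))

  ν[x^k∸1]≡ν[x^d∸1]+ν[k] : ∀ {x e d k} → ν p (x ^ d ∸ 1) ≡ suc e → p ∣ p C 2 ⊎ 1 ≤ e →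
                           ¬ p ∣ d → d ∣ k → 0 < k → ν p (x ^ k ∸ 1) ≡ suc e + ν p k
  ν[x^k∸1]≡ν[x^d∸1]+ν[k] {d = zero} _ _ p∤0 _ _ = contradiction (p ∣0) p∤0
  ν[x^k∸1]≡ν[x^d∸1]+ν[k] {d = suc _} _ _ _ (divides zero refl) ()
  ν[x^k∸1]≡ν[x^d∸1]+ν[k] {x} {e} {d@(suc _)} νxᵈ≡1+e side p∤d (divides j@(suc _) refl) _ = begin
    ν p (x ^ (j * d) ∸ 1)      ≡⟨ cong (λ n → ν p (x ^ n ∸ 1)) (*-comm j d) ⟩
    ν p (x ^ (d * j) ∸ 1)      ≡⟨ cong (λ y → ν p (y ∸ 1)) (^-*-assoc x d j) ⟨
    ν p ((x ^ d) ^ j ∸ 1)      ≡⟨ ν[x^n∸1]≡ν[x∸1]+ν[n] {x ^ d} νxᵈ≡1+e side z<s ⟩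
    suc e + ν p j              ≡⟨ cong (suc e +_) ν[j*d]≡ν[j] ⟨
    suc e + ν p (j * d)        ∎
    where
    open ≡-Reasoning
    ν[j*d]≡ν[j] : ν p (j * d) ≡ ν p j
    ν[j*d]≡ν[j] = trans (ν-* z<s z<s) (trans (cong (ν p j +_) (p∤n⇒ν≡0 p∤d)) (+-identityʳ (ν p j)))

ν₂[3^k∸1]≡2+ν₂[k] : ∀ {k} → 2 ∣ k → 0 < k → ν 2 (3 ^ k ∸ 1) ≡ 2 + ν 2 k
ν₂[3^k∸1]≡2+ν₂[k] (divides zero refl) ()
ν₂[3^k∸1]≡2+ν₂[k] (divides j@(suc _) refl) _ = begin
  ν 2 (3 ^ (j * 2) ∸ 1)  ≡⟨ cong (λ n → ν 2 (3 ^ n ∸ 1)) (*-comm j 2) ⟩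
  ν 2 (3 ^ (2 * j) ∸ 1)  ≡⟨ cong (λ y → ν 2 (y ∸ 1)) (^-*-assoc 3 2 j) ⟨
  ν 2 (9 ^ j ∸ 1)        ≡⟨ ν[x^n∸1]≡ν[x∸1]+ν[n] prime[2] {x = 9} refl (inj₂ (s≤s z≤n)) z<s ⟩
  3 + ν 2 j              ≡⟨ cong (2 +_) (ν-* prime[2] {2} z<s z<s) ⟨
  2 + ν 2 (2 * j)        ≡⟨ cong (λ n → 2 + ν 2 n) (*-comm 2 j) ⟩
  2 + ν 2 (j * 2)        ∎
  where open ≡-Reasoning

module PowerEquation {q k y : ℕ} (q-prime : Prime q) (0<k : 0 < k) (0<y : 0 < y)
         (N≡y^q : (2 ^ k ∸ 1) * (3 ^ k ∸ 1) ≡ y ^ q) where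

  q∣ν[2^k∸1]+ν[3^k∸1] : ∀ {p} → Prime p → q ∣ ν p (2 ^ k ∸ 1) + ν p (3 ^ k ∸ 1)
  q∣ν[2^k∸1]+ν[3^k∸1] {p} p-prime = divides (ν p y) (begin
    ν p (2 ^ k ∸ 1) + ν p (3 ^ k ∸ 1)    ≡⟨ ν-* p-prime (0<x^k∸1 2 0<k) (0<x^k∸1 3 0<k) ⟨
    ν p ((2 ^ k ∸ 1) * (3 ^ k ∸ 1))      ≡⟨ cong (ν p) N≡y^q ⟩
    ν p (y ^ q)                          ≡⟨ ν-^ p-prime q 0<y ⟩
    q * ν p y                            ≡⟨ *-comm q (ν p y) ⟩
    ν p y * q                            ∎)
    where open ≡-Reasoning

  ν₂[k]≥q∸2 : ν 2 k ≥ q ∸ 2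
  ν₂[k]≥q∸2 with 2 ∣? k
  ... | no 2∤k =
    contradiction (∣1⇒≡1 (subst (q ∣_) ν₂[N]≡1 (q∣ν[2^k∸1]+ν[3^k∸1] prime[2]))) nonTrivial⇒≢1
    where
    ν₂[N]≡1 : ν 2 (2 ^ k ∸ 1) + ν 2 (3 ^ k ∸ 1) ≡ 1
    ν₂[N]≡1 = cong₂ _+_ (ν[x^k∸1]≡0 ∣-refl 0<k) (ν[x^n∸1]≡ν[x∸1] prime[2] {x = 3} refl 2∤k)
  ... | yes 2∣k =
    m≤n+o⇒m∸n≤o q 2 (∣⇒≤ (subst (q ∣_) ν₂[N]≡2+ν₂[k] (q∣ν[2^k∸1]+ν[3^k∸1] prime[2])))
    where
    ν₂[N]≡2+ν₂[k] : ν 2 (2 ^ k ∸ 1) + ν 2 (3 ^ k ∸ 1) ≡ 2 + ν 2 k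
    ν₂[N]≡2+ν₂[k] = cong₂ _+_ (ν[x^k∸1]≡0 ∣-refl 0<k) (ν₂[3^k∸1]≡2+ν₂[k] 2∣k 0<k)

  2^c∣k : ∀ c → c + 2 ≤ q → 2 ^ c ∣ k
  2^c∣k c c+2≤q = p^v∣n (≤-trans (m+n≤o⇒m≤o∸n c c+2≤q) ν₂[k]≥q∸2) 0<k

  ν₃[k]≥q∸1 : 3 ≤ q → ν 3 k ≥ q ∸ 1
  ν₃[k]≥q∸1 3≤q =
    m≤n+o⇒m∸n≤o q 1 (∣⇒≤ (subst (q ∣_) ν₃[N]≡1+ν₃[k] (q∣ν[2^k∸1]+ν[3^k∸1] prime[3])))
    where
    ν₃[N]≡1+ν₃[k] : ν 3 (2 ^ k ∸ 1) + ν 3 (3 ^ k ∸ 1) ≡ 1 + ν 3 k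
    ν₃[N]≡1+ν₃[k] = trans (cong₂ _+_
      (ν[x^k∸1]≡ν[x^d∸1]+ν[k] prime[3] {x = 2} refl (inj₁ ∣-refl) (>⇒∤ ≤-refl) (2^c∣k 1 3≤q) 0<k)
      (ν[x^k∸1]≡0 ∣-refl 0<k)) (+-identityʳ _)

  q∸1≤ν[k] : ∀ {p d} → Prime p → p ∣ p C 2 → ¬ p ∣ d → d ∣ k →
             ν p (2 ^ d ∸ 1) ≡ 1 → ν p (3 ^ d ∸ 1) ≡ 1 → 3 ≤ q → q ∸ 1 ≤ ν p k
  q∸1≤ν[k] {p} {d} p-prime p∣pC2 p∤d d∣k ν[2ᵈ∸1]≡1 ν[3ᵈ∸1]≡1 3≤q =
    m≤n+o⇒m∸n≤o q 1 (∣⇒≤ (p∣n+n⇒p∣n q-prime 3≤q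
      (subst (q ∣_) (cong₂ _+_ (lift ν[2ᵈ∸1]≡1) (lift ν[3ᵈ∸1]≡1)) (q∣ν[2^k∸1]+ν[3^k∸1] p-prime))))
    where
    lift : ∀ {x} → ν p (x ^ d ∸ 1) ≡ 1 → ν p (x ^ k ∸ 1) ≡ 1 + ν p k
    lift νxᵈ≡1 = ν[x^k∸1]≡ν[x^d∸1]+ν[k] p-prime νxᵈ≡1 (inj₁ p∣pC2) p∤d d∣k 0<k

  ν₅[k]≥q∸1 : 5 ≤ q → ν 5 k ≥ q ∸ 1
  ν₅[k]≥q∸1 5≤q =
    q∸1≤ν[k] prime[5] (divides 2 refl) (>⇒∤ ≤-refl) (2^c∣k 2 (<⇒≤ 5≤q)) refl refl
      (≤-trans (s≤s (s≤s (s≤s z≤n))) 5≤q)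

  ν₇[k]≥q∸1 : 7 ≤ q → ν 7 k ≥ q ∸ 1
  ν₇[k]≥q∸1 7≤q =
    q∸1≤ν[k] prime[7] (divides 3 refl) (>⇒∤ ≤-refl) (lcm-least 2∣k 3∣k) refl refl 3≤q
    where
    3≤q : 3 ≤ q
    3≤q = ≤-trans (s≤s (s≤s (s≤s z≤n))) 7≤q
    2∣k : 2 ∣ k
    2∣k = 2^c∣k 1 3≤q
    3∣k : 3 ∣ k
    3∣k = p^v∣n (≤-trans (s≤s z≤n) (≤-trans (∸-monoˡ-≤ 1 7≤q) (ν₃[k]≥q∸1 3≤q))) 0<k

lemma3 : (q k y : ℕ) → Prime q → 0 < k → 0 < y →
         (2 ^ k ∸ 1) * (3 ^ k ∸ 1) ≡ y ^ q →
         (ν 2 k ≥ q ∸ 2) ×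
         ((p : ℕ) → (p ≡ 3 ⊎ p ≡ 5 ⊎ p ≡ 7) → p ≤ q → ν p k ≥ q ∸ 1)
lemma3 q k y q-prime 0<k 0<y N≡y^q = ν₂[k]≥q∸2 , λ where
    _ (inj₁ refl)        → ν₃[k]≥q∸1
    _ (inj₂ (inj₁ refl)) → ν₅[k]≥q∸1
    _ (inj₂ (inj₂ refl)) → ν₇[k]≥q∸1
  where open PowerEquation q-prime 0<k 0<y N≡y^q
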